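{- For integers $m,n\ge 1$, let $\mathcal{P}$ be a coarsening of the column set of $(m+4)P_n$ with $|\mathcal{P}|=k\ge 2$. Then every $\mathcal{P}$-flip of $(m+4)P_n$ has a pivot-minor isomorphic to a $(k-1)$-flipped $mP_n$.
   Context: Graphs are finite and simple. Local complementation: $G\ast x:=(V(G),E(G)\triangle\{yz:y,z\in N_G(x),y\neq z\})$; pivoting an edge $uv$: $G\wedge uv:=G\ast u\ast v\ast u$; a pivot-minor is obtained by a (possibly empty) sequence of vertex deletions and pivotings. $mP_n$ is the disjoint union of $m$ copies of $P_n$, with vertex set $[m]\times[n]$, $(i,j)$ being the $j$-th vertex of the $i$-th path; the $j$-th column is $\{(i,j):i\in[m]\}$; the column set is the set of all columns. A coarsening of a collection $\mathcal{P}$ of disjoint sets is a collection of pairwise disjoint non-empty sets each a union of members of $\mathcal{P}$. $F\subseteq\mathcal{P}^2$ is symmetric if $(X,X')\in F\Rightarrow(X',X)\in F$. For a graph $H$ and a collection $\mathcal{P}$ of pairwise disjoint non-empty subsets of $V(H)$, let $\mathcal{P}(v)$ be the member of $\mathcal{P}$ containing $v$ if any, else $\{v\}$. The $(\mathcal{P},F)$-flip of $H$ has vertex set $V(H)$ and distinct $u,v$ adjacent iff either $uv\notin E(H)$ and $(\mathcal{P}(u),\mathcal{P}(v))\in F$, or $uv\in E(H)$ and $(\mathcal{P}(u),\mathcal{P}(v))\notin F$. A $\mathcal{P}$-flip is a $(\mathcal{P},F)$-flip for some symmetric $F\subseteq\mathcal{P}^2$. A $k$-flipped $mP_n$ is a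 $\mathcal{P}'$-flip of $mP_n$ where $\mathcal{P}'$ is a coarsening of the column set of $mP_n$ with $|\mathcal{P}'|\le k$. -}

module Defs where

open import Data.Bool using (Bool; true; false; not; _∧_; _∨_; _xor_; if_then_else_)
open import Data.Bool.Properties using (∧-comm; ∨-comm)
open import Data.Nat as ℕ using (ℕ; zero; suc; _≤_; _*_)
import Data.Nat.Properties as ℕP
open import Data.Fin using (Fin; toℕ; remQuot; punchIn)
open import Data.Fin.Properties using (_≟_)
open import Data.Maybe using (Maybe; just; nothing)
open import Data.Product using (Σ; Σ-syntax; _×_; _,_; proj₁; proj₂)
open import Function.Bundles using (_↔_; Inverse)
open import Relation.Binary.PropositionalEquality using (_≡_; refl; sym; cong; cong₂)
open import Relation.Nullary using (yes; no)
open import Relation.Nullary.Decidable using (⌊_⌋)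

record Graph (N : ℕ) : Set where
  field
    adj  : Fin N → Fin N → Bool
    adjSym : ∀ x y → adj x y ≡ adj y x
    adjIrr : ∀ x → adj x x ≡ false
open Graph public

eqF : ∀ {N} → Fin N → Fin N → Bool
eqF x y = ⌊ x ≟ y ⌋

eqF-sym : ∀ {N} (x y : Fin N) → eqF x y ≡ eqF y x
eqF-sym x y with x ≟ y | y ≟ x
... | yes _ | yes _ = refl
... | no _  | no _  = refl
... | yes p | no q  = Data.Empty.⊥-elim (q (sym p)) where import Data.Empty
... | no p  | yes q = Data.Empty.⊥-elim (p (sym q)) where import Data.Empty

eqF-refl : ∀ {N} (x : Fin N) → eqF x x ≡ true
eqF-refl x with x ≟ x
... | yes _ = refl
... | no p  = Data.Empty.⊥-elim (p refl) where import Data.Empty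

eqN : ℕ → ℕ → Bool
eqN a b = ⌊ a ℕP.≟ b ⌋

eqN-suc : ∀ a → eqN a (suc a) ≡ false
eqN-suc a with a ℕP.≟ suc a
... | no _  = refl
... | yes p = Data.Empty.⊥-elim (ℕP.<-irrefl p (ℕP.n<1+n a)) where import Data.Empty

toggle : ∀ {N} (G : Graph N) (S : Fin N → Fin N → Bool) →
         (∀ y z → S y z ≡ S z y) → Graph N
toggle G S Ssym = record
  { adj = λ y z → adj G y z xor (not (eqF y z) ∧ S y z)
  ; adjSym = λ y z → cong₂ _xor_ (Graph.adjSym G y z)
                   (cong₂ _∧_ (cong not (eqF-sym y z)) (Ssym y z))
  ; adjIrr = λ y → irrLemma y
  }
  where
  irrLemma : ∀ y → adj G y y xor (not (eqF y y) ∧ S y y) ≡ false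
  irrLemma y rewrite eqF-refl y | Graph.adjIrr G y = refl

localComp : ∀ {N} → Graph N → Fin N → Graph N
localComp G x = toggle G (λ y z → adj G x y ∧ adj G x z)
                         (λ y z → ∧-comm (adj G x y) (adj G x z))

pivot : ∀ {N} → Graph N → Fin N → Fin N → Graph N
pivot G u v = localComp (localComp (localComp G u) v) u

delete : ∀ {N} → Graph (suc N) → Fin (suc N) → Graph N
delete G v = record
  { adj = λ x y → adj G (punchIn v x) (punchIn v y)
  ; adjSym = λ x y → Graph.adjSym G (punchIn v x) (punchIn v y)
  ; adjIrr = λ x → Graph.adjIrr G (punchIn v x)
  }

data _≥ₚ_ : ∀ {N M} → Graph N → Graph M → Set where
  done : ∀ {N} {G : Graph N} → G ≥ₚ G
  piv  : ∀ {N M} {G : Graph N} {H : Graph M} (u v : Fin N) →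
         adj G u v ≡ true → pivot G u v ≥ₚ H → G ≥ₚ H
  del  : ∀ {N M} {G : Graph (suc N)} {H : Graph M} (v : Fin (suc N)) →
         delete G v ≥ₚ H → G ≥ₚ H

Iso : ∀ {N M} → Graph N → Graph M → Set
Iso {N} {M} G H = Σ[ f ∈ (Fin N ↔ Fin M) ]
  (∀ x y → adj H (Inverse.to f x) (Inverse.to f y) ≡ adj G x y)

-- m P_n : vertex (i , j) ∈ [m] × [n] is encoded as combine i j : Fin (m * n),
-- decoded by remQuot n.

pathIdx : ∀ m n → Fin (m * n) → Fin m
pathIdx m n u = proj₁ (remQuot {m} n u)

col : ∀ m n → Fin (m * n) → Fin n
col m n u = proj₂ (remQuot {m} n u)

consec : ℕ → ℕ → Bool
consec a b = eqN b (suc a) ∨ eqN a (suc b)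

consec-sym : ∀ a b → consec a b ≡ consec b a
consec-sym a b = ∨-comm (eqN b (suc a)) (eqN a (suc b))

mPn : ∀ m n → Graph (m * n)
mPn m n = record
  { adj = λ u v → eqF (pathIdx m n u) (pathIdx m n v)
                  ∧ consec (toℕ (col m n u)) (toℕ (col m n v))
  ; adjSym = λ u v → cong₂ _∧_ (eqF-sym (pathIdx m n u) (pathIdx m n v))
                            (consec-sym (toℕ (col m n u)) (toℕ (col m n v)))
  ; adjIrr = λ u → irrL u
  }
  where
  irrL : ∀ u → eqF (pathIdx m n u) (pathIdx m n u)
               ∧ consec (toℕ (col m n u)) (toℕ (col m n u)) ≡ false
  irrL u rewrite eqN-suc (toℕ (col m n u)) | Data.Bool.Properties.∧-zeroʳ (eqF (pathIdx m n u) (pathIdx m n u)) = refl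
    where import Data.Bool.Properties

-- Coarsenings of the column set {column 1, ..., column n} with exactly k
-- parts: column j belongs to part a iff assign j ≡ just a, and is in no
-- part iff assign j ≡ nothing.  Each part is non-empty; parts are
-- pairwise disjoint (a function) and indexed by Fin k, so there are k of them.
record Coarsening (n k : ℕ) : Set where
  field
    assign   : Fin n → Maybe (Fin k)
    nonempty : ∀ (a : Fin k) → Σ[ j ∈ Fin n ] assign j ≡ just a
open Coarsening public

record SymRel (k : ℕ) : Set where
  field
    rel    : Fin k → Fin k → Bool
    relSym : ∀ a b → rel a b ≡ rel b a
open SymRel public

inF : ∀ {k} → SymRel k → Maybe (Fin k) → Maybe (Fin k) → Bool
inF F (just a) (just b) = rel F a b
inF F _        _        = false

inF-sym : ∀ {k} (F : SymRel k) x y → inF F x y ≡ inF F y x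
inF-sym F (just a) (just b) = relSym F a b
inF-sym F (just a) nothing  = refl
inF-sym F nothing  (just b) = refl
inF-sym F nothing  nothing  = refl

-- (P , F)-flip of m P_n, where P is a coarsening of its column set.
-- Vertices in columns outside every part have P(v) = {v} ∉ P, so pairs
-- involving them are never flipped.
flipPaths : ∀ m n {k} → Coarsening n k → SymRel k → Graph (m * n)
flipPaths m n P F =
  toggle (mPn m n)
         (λ u v → inF F (assign P (col m n u)) (assign P (col m n v)))
         (λ u v → inF-sym F (assign P (col m n u)) (assign P (col m n v)))

IsoKFlipped : ∀ {N} → ℕ → (m n : ℕ) → Graph N → Set
IsoKFlipped k m n H =
  Σ[ k' ∈ ℕ ] (k' ≤ k) × Σ[ P ∈ Coarsening n k' ] Σ[ F ∈ SymRel k' ]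
    Iso H (flipPaths m n P F)

module Submission where

-- On its first m paths, a flip of (m + 4) P n is the flip of m P n by a
-- symmetric relation Φ on the parts, and a vertex on one of the spare paths
-- sees these paths only through the row F(X , ·) of the part X of its
-- column (its profile).  Pivoting an edge uv between spare vertices with
-- profiles a and b keeps this shape, replacing Φ by Φ + a bᵀ + b aᵀ over 𝔽₂;
-- deleting the spare paths at the end leaves a flip of m P n.  So it
-- suffices to make one row of Φ zero (that part is dropped) or two rows
-- equal (those parts are merged), which leaves k − 1 parts.
--
-- If F(X , X) = 0 for some part X, one pivot between X and a part Z with
-- F(X , Z) = 1 on two spare paths makes row X zero.  Otherwise walk along
-- the spare path E₀ from a column of a part A: pivoting the current vertex
-- with its unlabelled successor moves a vertex of profile F(A , ·) two
-- columns on, until it reaches the next column l of a part Y ≠ A.  Unless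
-- rows A and Y already agree, some part W separates them, and one or two
-- further pivots, using ⟨ E₀ , l ⟩, its copy on E₁ and a vertex of part W
-- on E₂, make rows A and Y equal.

open import Defs
open import Level using (0ℓ)
open import Data.Bool using (Bool; true; false; not; _∧_; _xor_)
import Data.Bool.Properties as Bool
open import Data.Empty using (⊥-elim)
open import Data.Fin as Fin using (Fin; toℕ; fromℕ; fromℕ<; punchIn; punchOut; combine; _↑ˡ_; _↑ʳ_)
import Data.Fin.Properties as FinP
open import Data.List using (_∷_; [])
open import Data.Maybe using (Maybe; just; nothing; maybe′)
open import Data.Maybe.Properties using (just-injective)
open import Data.Nat using (ℕ; zero; suc; _+_; _*_; _∸_; _≤_; _<_; s≤s; z≤n; _≤′_; ≤′-refl; ≤′-step)
import Data.Nat.Properties as ℕP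
open import Data.Product using (Σ-syntax; _×_; _,_; proj₁; proj₂)
open import Function using (_∘_)
open import Function.Construct.Identity using (↔-id)
open import Relation.Binary.Definitions using (tri<; tri≈; tri>)
open import Relation.Binary.PropositionalEquality
open import Relation.Nullary using (¬_; yes; no)
open import Relation.Nullary.Decidable using (dec-true; dec-false; isYes≗does)
import Tactic.RingSolver.Core.AlmostCommutativeRing as ACR
open import Tactic.RingSolver using (solve)

-- Bool as the field with two elements, so that the ring solver reasons modulo 2.
𝔽₂ : ACR.AlmostCommutativeRing 0ℓ 0ℓ
𝔽₂ = ACR.fromCommutativeRing Bool.xor-∧-commutativeRing λ { false → just refl ; true → nothing }

eqF-≡ : ∀ {N} {x y : Fin N} → x ≡ y → eqF x y ≡ true
eqF-≡ {x = x} refl = eqF-refl x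

eqF-≢ : ∀ {N} {x y : Fin N} → x ≢ y → eqF x y ≡ false
eqF-≢ {x = x} {y} x≢y = trans (isYes≗does (x FinP.≟ y)) (dec-false (x FinP.≟ y) x≢y)

eqN-≡ : ∀ {a b} → a ≡ b → eqN a b ≡ true
eqN-≡ {a} {b} a≡b = trans (isYes≗does (a ℕP.≟ b)) (dec-true (a ℕP.≟ b) a≡b)

eqN-≢ : ∀ {a b} → a ≢ b → eqN a b ≡ false
eqN-≢ {a} {b} a≢b = trans (isYes≗does (a ℕP.≟ b)) (dec-false (a ℕP.≟ b) a≢b)

eqF-cong-toℕ : ∀ {N N′} {x y : Fin N} {x′ y′ : Fin N′} →
  toℕ x ≡ toℕ x′ → toℕ y ≡ toℕ y′ → eqF x y ≡ eqF x′ y′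
eqF-cong-toℕ {x = x} {y} x≡ y≡ with x FinP.≟ y
... | yes x≡y = sym (eqF-≡ (FinP.toℕ-injective (trans (sym x≡) (trans (cong toℕ x≡y) y≡))))
... | no  x≢y = sym (eqF-≢ λ x′≡y′ →
  x≢y (FinP.toℕ-injective (trans x≡ (trans (cong toℕ x′≡y′) (sym y≡)))))

consec-far : ∀ {a b} → a < b → b ≢ suc a → consec a b ≡ false
consec-far {a} {b} a<b b≢1+a
  rewrite eqN-≢ b≢1+a
        | eqN-≢ {a} {suc b} (λ a≡1+b → ℕP.<-asym a<b (subst (b <_) (sym a≡1+b) (ℕP.n<1+n b)))
  = refl

outside-≢ : ∀ {N} {A : Fin N → Set} {x y} → ¬ A x → A y → x ≢ y
outside-≢ x∉A y∈A refl = x∉A y∈A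

adj⇒≢ : ∀ {N} (G : Graph N) {u v} → adj G u v ≡ true → u ≢ v
adj⇒≢ G {u} uv refl with () ← trans (sym uv) (adjIrr G u)

off-diagonal : ∀ {N} (G H : Graph N) {x y} → (x ≢ y → adj G x y ≡ adj H x y) → adj G x y ≡ adj H x y
off-diagonal G H {x} {y} agree with x FinP.≟ y
... | yes refl = trans (adjIrr G x) (sym (adjIrr H x))
... | no  x≢y  = agree x≢y

adj-localComp : ∀ {N} (G : Graph N) x {y z} → y ≢ z →
  adj (localComp G x) y z ≡ adj G y z xor (adj G x y ∧ adj G x z)
adj-localComp G x y≢z rewrite eqF-≢ y≢z = refl

adj-pivot : ∀ {N} (G : Graph N) {u v x y} → adj G u v ≡ true →
  x ≢ y → u ≢ x → u ≢ y → v ≢ x → v ≢ y →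
  adj (pivot G u v) x y ≡ adj G x y xor ((adj G u x ∧ adj G v y) xor (adj G v x ∧ adj G u y))
adj-pivot G {u} {v} {x} {y} uv x≢y u≢x u≢y v≢x v≢y
  rewrite adj-localComp (localComp (localComp G u) v) u x≢y
        | adj-localComp (localComp G u) v x≢y
        | adj-localComp (localComp G u) v u≢x
        | adj-localComp (localComp G u) v u≢y
        | adj-localComp G u x≢y | adj-localComp G u v≢x | adj-localComp G u v≢y
        | adj-localComp G u u≢x | adj-localComp G u u≢y
        | adj-localComp G u (λ v≡u → adj⇒≢ G uv (sym v≡u))
        | adjIrr G u | adjSym G v u | uv
  with adj G x y | adj G u x | adj G u y | adj G v x | adj G v y
... | e | a | b | c | d = solve (e ∷ a ∷ b ∷ c ∷ d ∷ []) 𝔽₂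

module PivotPendant {N} (G : Graph N) (A : Fin N → Set) {u v w}
  (uv : adj G u v ≡ true) (u∉A : ¬ A u) (v∉A : ¬ A v) (w∈A : A w) (vw : adj G v w ≡ true)
  (only-w : ∀ {y} → A y → w ≢ y → adj G v y ≡ false) where

  unchanged : ∀ {x y} → A x → A y → w ≢ x → w ≢ y → adj (pivot G u v) x y ≡ adj G x y
  unchanged {x} {y} x∈A y∈A w≢x w≢y = off-diagonal (pivot G u v) G off
    where
    off : x ≢ y → adj (pivot G u v) x y ≡ adj G x y
    off x≢y
      rewrite adj-pivot G uv x≢y (outside-≢ u∉A x∈A) (outside-≢ u∉A y∈A)
                        (outside-≢ v∉A x∈A) (outside-≢ v∉A y∈A)
            | only-w x∈A w≢x | only-w y∈A w≢y
      with adj G x y | adj G u x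
    ... | e | a = solve (e ∷ a ∷ []) 𝔽₂

  added : ∀ {y} → A y → w ≢ y → adj (pivot G u v) w y ≡ adj G w y xor adj G u y
  added {y} y∈A w≢y
    rewrite adj-pivot G uv w≢y (outside-≢ u∉A w∈A) (outside-≢ u∉A y∈A)
                      (adj⇒≢ G vw) (outside-≢ v∉A y∈A)
          | vw | only-w y∈A w≢y
    with adj G w y | adj G u w
  ... | e | a = solve (e ∷ a ∷ []) 𝔽₂

≥ₚ-trans : ∀ {N M K} {G : Graph N} {H : Graph M} {J : Graph K} → G ≥ₚ H → H ≥ₚ J → G ≥ₚ J
≥ₚ-trans done          H≥J = H≥J
≥ₚ-trans (piv u v h p) H≥J = piv u v h (≥ₚ-trans p H≥J)
≥ₚ-trans (del v p)     H≥J = del v (≥ₚ-trans p H≥J)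

toℕ-punchIn-fromℕ : ∀ {N} (x : Fin N) → toℕ (punchIn (fromℕ N) x) ≡ toℕ x
toℕ-punchIn-fromℕ Fin.zero    = refl
toℕ-punchIn-fromℕ (Fin.suc x) = cong suc (toℕ-punchIn-fromℕ x)

record InitialSegment {N′} (G : Graph N′) (N : ℕ) : Set where
  field
    graph     : Graph N
    isMinor   : G ≥ₚ graph
    embed     : Fin N → Fin N′
    toℕ-embed : ∀ x → toℕ (embed x) ≡ toℕ x
    adj-embed : ∀ x y → adj graph x y ≡ adj G (embed x) (embed y)

initialSegment : ∀ {N N′} → N ≤′ N′ → (G : Graph N′) → InitialSegment G N
initialSegment ≤′-refl G = record
  { graph = G ; isMinor = done ; embed = λ x → x
  ; toℕ-embed = λ _ → refl ; adj-embed = λ _ _ → refl }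
initialSegment (≤′-step N≤N′) G = record
  { graph = graph ; isMinor = del (fromℕ _) isMinor
  ; embed = λ x → punchIn (fromℕ _) (embed x)
  ; toℕ-embed = λ x → trans (toℕ-punchIn-fromℕ (embed x)) (toℕ-embed x)
  ; adj-embed = adj-embed }
  where open InitialSegment (initialSegment N≤N′ (delete G (fromℕ _)))

lift : ∀ {k} → (Fin k → Bool) → Maybe (Fin k) → Bool
lift a = maybe′ a false

inF-just : ∀ {k} (Φ : SymRel k) X q → inF Φ (just X) q ≡ lift (rel Φ X) q
inF-just Φ X nothing  = refl
inF-just Φ X (just _) = refl

-- The change of a flip under pivoting two vertices with profiles a and b.
_⊕_⊗_ : ∀ {k} → SymRel k → (Fin k → Bool) → (Fin k → Bool) → SymRel k
Φ ⊕ a ⊗ b = record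
  { rel    = λ X Y → rel Φ X Y xor ((a X ∧ b Y) xor (b X ∧ a Y))
  ; relSym = symmetric }
  where
  symmetric : ∀ X Y → rel Φ X Y xor ((a X ∧ b Y) xor (b X ∧ a Y))
                    ≡ rel Φ Y X xor ((a Y ∧ b X) xor (b Y ∧ a X))
  symmetric X Y rewrite relSym Φ X Y with rel Φ Y X | a X | a Y | b X | b Y
  ... | φ | aX | aY | bX | bY = solve (φ ∷ aX ∷ aY ∷ bX ∷ bY ∷ []) 𝔽₂

inF-⊕⊗ : ∀ {k} (Φ : SymRel k) a b p q →
  inF (Φ ⊕ a ⊗ b) p q ≡ inF Φ p q xor ((lift a p ∧ lift b q) xor (lift b p ∧ lift a q))
inF-⊕⊗ Φ a b nothing  q        = refl
inF-⊕⊗ Φ a b (just X) nothing  rewrite Bool.∧-zeroʳ (a X) | Bool.∧-zeroʳ (b X) = refl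
inF-⊕⊗ Φ a b (just X) (just Y) = refl

⊕⊗-diagonal : ∀ {k} (Φ : SymRel k) a b X → rel (Φ ⊕ a ⊗ b) X X ≡ rel Φ X X
⊕⊗-diagonal Φ a b X with rel Φ X X | a X | b X
... | φ | aX | bX = solve (φ ∷ aX ∷ bX ∷ []) 𝔽₂

⊕⊗-zero-row : ∀ {k} (Φ : SymRel k) {X Z} → rel Φ X X ≡ false → rel Φ X Z ≡ true →
  ∀ W → rel (Φ ⊕ rel Φ X ⊗ rel Φ Z) X W ≡ false
⊕⊗-zero-row Φ {X} {Z} XX XZ W rewrite XX | relSym Φ Z X | XZ = Bool.xor-same (rel Φ X W)

⊕⊗-merge-rows : ∀ {k} (Φ : SymRel k) {X Y} →
  rel Φ X X ≡ true → rel Φ Y Y ≡ true → rel Φ X Y ≡ false →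
  ∀ Z → rel (Φ ⊕ rel Φ X ⊗ rel Φ Y) X Z ≡ rel (Φ ⊕ rel Φ X ⊗ rel Φ Y) Y Z
⊕⊗-merge-rows Φ {X} {Y} XX YY XY Z rewrite XX | YY | relSym Φ Y X | XY
  with rel Φ X Z | rel Φ Y Z
... | x | y = solve (x ∷ y ∷ []) 𝔽₂

⊕⊗-merge-difference : ∀ {k} (Φ : SymRel k) {X Y d c} → rel Φ X X ≡ rel Φ Y Y →
  (∀ Z → d Z ≡ rel Φ X Z xor rel Φ Y Z) → c X ≡ not (c Y) →
  ∀ Z → rel (Φ ⊕ d ⊗ c) X Z ≡ rel (Φ ⊕ d ⊗ c) Y Z
⊕⊗-merge-difference Φ {X} {Y} {d} {c} XX≡YY d≡ cX≡ Z
  rewrite d≡ X | d≡ Y | d≡ Z | cX≡ | XX≡YY | relSym Φ Y X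
  with rel Φ X Z | rel Φ Y Z | rel Φ X Y | rel Φ Y Y | c Y | c Z
... | x | y | xy | yy | false | cZ = solve (x ∷ y ∷ xy ∷ yy ∷ cZ ∷ []) 𝔽₂
... | x | y | xy | yy | true  | cZ = solve (x ∷ y ∷ xy ∷ yy ∷ cZ ∷ []) 𝔽₂

⊕⊗-merge-via-copy : ∀ {k} (Φ : SymRel k) {X Y W} →
  rel Φ X X ≡ true → rel Φ Y Y ≡ true → rel Φ X Y ≡ true → rel Φ X W ≡ not (rel Φ Y W) →
  let Φ₁ = Φ ⊕ rel Φ X ⊗ rel Φ Y
      d  = λ Z → rel Φ Y Z xor rel Φ X Z
      c  = λ Z → rel Φ W Z xor ((rel Φ X W ∧ rel Φ Y Z) xor (rel Φ Y W ∧ rel Φ X Z))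
  in ∀ Z → rel (Φ₁ ⊕ d ⊗ c) X Z ≡ rel (Φ₁ ⊕ d ⊗ c) Y Z
⊕⊗-merge-via-copy Φ {X} {Y} {W} XX YY XY XW =
  ⊕⊗-merge-difference (Φ ⊕ rel Φ X ⊗ rel Φ Y) diagonal difference separates
  where
  diagonal : rel (Φ ⊕ rel Φ X ⊗ rel Φ Y) X X ≡ rel (Φ ⊕ rel Φ X ⊗ rel Φ Y) Y Y
  diagonal = trans (⊕⊗-diagonal Φ (rel Φ X) (rel Φ Y) X)
                   (trans (trans XX (sym YY)) (sym (⊕⊗-diagonal Φ (rel Φ X) (rel Φ Y) Y)))
  difference : ∀ Z → rel Φ Y Z xor rel Φ X Z
                     ≡ rel (Φ ⊕ rel Φ X ⊗ rel Φ Y) X Z xor rel (Φ ⊕ rel Φ X ⊗ rel Φ Y) Y Z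
  difference Z rewrite XX | YY | relSym Φ Y X | XY with rel Φ X Z | rel Φ Y Z
  ... | x | y = solve (x ∷ y ∷ []) 𝔽₂
  separates : rel Φ W X xor ((rel Φ X W ∧ rel Φ Y X) xor (rel Φ Y W ∧ rel Φ X X))
            ≡ not (rel Φ W Y xor ((rel Φ X W ∧ rel Φ Y Y) xor (rel Φ Y W ∧ rel Φ X Y)))
  separates rewrite relSym Φ W X | relSym Φ W Y | XX | YY | relSym Φ Y X | XY | XW with rel Φ Y W
  ... | false = refl
  ... | true  = refl

module FlipRepresentation {N k} (B : Graph N) (label : Fin N → Maybe (Fin k)) (S : Fin N → Set) where

  flipBy : SymRel k → Graph N
  flipBy Φ = toggle B (λ x y → inF Φ (label x) (label y)) (λ x y → inF-sym Φ (label x) (label y))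

  record FlipOn (G : Graph N) (Φ : SymRel k) : Set where
    constructor flipOn
    field adj-flip : ∀ {x y} → S x → S y → adj G x y ≡ adj (flipBy Φ) x y

  record HasProfile (G : Graph N) (u : Fin N) (a : Fin k → Bool) : Set where
    constructor hasProfile
    field adj-profile : ∀ {y} → S y → adj G u y ≡ lift a (label y)

  open FlipOn public
  open HasProfile public

  pivot-flipOn : ∀ {G Φ u v a b} → FlipOn G Φ → HasProfile G u a → HasProfile G v b →
    ¬ S u → ¬ S v → adj G u v ≡ true → FlipOn (pivot G u v) (Φ ⊕ a ⊗ b)
  pivot-flipOn {G} {Φ} {u} {v} {a} {b} G↦Φ u↦a v↦b u∉S v∉S uv = flipOn λ {x} {y} x∈S y∈S →
    off-diagonal (pivot G u v) (flipBy (Φ ⊕ a ⊗ b)) (off x∈S y∈S)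
    where
    off : ∀ {x y} → S x → S y → x ≢ y → adj (pivot G u v) x y ≡ adj (flipBy (Φ ⊕ a ⊗ b)) x y
    off {x} {y} x∈S y∈S x≢y
      rewrite adj-pivot G uv x≢y (outside-≢ u∉S x∈S) (outside-≢ u∉S y∈S)
                        (outside-≢ v∉S x∈S) (outside-≢ v∉S y∈S)
            | adj-flip G↦Φ x∈S y∈S | adj-profile u↦a x∈S | adj-profile u↦a y∈S
            | adj-profile v↦b x∈S | adj-profile v↦b y∈S
            | eqF-≢ x≢y | inF-⊕⊗ Φ a b (label x) (label y)
      = Bool.xor-assoc (adj B x y) (inF Φ (label x) (label y)) _

  pivot-profile : ∀ {G u v w a b c α β} → HasProfile G u a → HasProfile G v b → HasProfile G w c →
    ¬ S u → ¬ S v → ¬ S w → adj G u v ≡ true → u ≢ w → v ≢ w →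
    adj G u w ≡ α → adj G v w ≡ β →
    HasProfile (pivot G u v) w (λ Z → c Z xor ((α ∧ b Z) xor (β ∧ a Z)))
  pivot-profile {G} {u} {v} {w} {a} {b} {c} {α} {β} u↦a v↦b w↦c u∉S v∉S w∉S uv u≢w v≢w uw≡α vw≡β =
    hasProfile λ y∈S →
      trans (adj-pivot G uv (outside-≢ w∉S y∈S) u≢w (outside-≢ u∉S y∈S) v≢w (outside-≢ v∉S y∈S))
            (expand y∈S)
    where
    lift-combination : ∀ q → lift c q xor ((α ∧ lift b q) xor (β ∧ lift a q))
                             ≡ lift (λ Z → c Z xor ((α ∧ b Z) xor (β ∧ a Z))) q
    lift-combination nothing  rewrite Bool.∧-zeroʳ α | Bool.∧-zeroʳ β = refl
    lift-combination (just Z) = refl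
    expand : ∀ {y} → S y → adj G w y xor ((adj G u w ∧ adj G v y) xor (adj G v w ∧ adj G u y))
                           ≡ lift (λ Z → c Z xor ((α ∧ b Z) xor (β ∧ a Z))) (label y)
    expand {y} y∈S
      rewrite adj-profile w↦c y∈S | adj-profile u↦a y∈S | adj-profile v↦b y∈S | uw≡α | vw≡β
      = lift-combination (label y)


-- t = just Y merges part X into part Y; t = nothing dissolves part X.
Mergeable : ∀ {k} → SymRel (suc k) → Set
Mergeable {k} Φ = Σ[ X ∈ Fin (suc k) ] Σ[ t ∈ Maybe (Fin (suc k)) ]
  t ≢ just X × (∀ Z → rel Φ X Z ≡ inF Φ t (just Z))

record Merged {n k} (P : Coarsening n (suc k)) (Φ : SymRel (suc k)) : Set where
  field
    coarsening : Coarsening n k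
    relation   : SymRel k
    inF-merged : ∀ i j → inF Φ (assign P i) (assign P j) ≡ inF relation (assign coarsening i) (assign coarsening j)

merge : ∀ {n k} (P : Coarsening n (suc k)) (Φ : SymRel (suc k)) → Mergeable Φ → Merged P Φ
merge {n} {k} P Φ (X , t , t≢X , rowX≡rowt) = record
  { coarsening = record { assign = relabel ∘ assign P ; nonempty = nonempty′ }
  ; relation   = Φ′
  ; inF-merged = λ i j → inF-relabel (assign P i) (assign P j) }
  where
  open ≡-Reasoning

  Φ′ : SymRel k
  Φ′ = record
    { rel    = λ a b → rel Φ (punchIn X a) (punchIn X b)
    ; relSym = λ a b → relSym Φ (punchIn X a) (punchIn X b) }

  shrink : (p : Maybe (Fin (suc k))) → p ≢ just X → Maybe (Fin k)
  shrink nothing  _   = nothing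
  shrink (just Z) Z≢X = just (punchOut λ X≡Z → Z≢X (cong just (sym X≡Z)))

  inF-shrink : ∀ {p q} (p≢X : p ≢ just X) (q≢X : q ≢ just X) →
    inF Φ p q ≡ inF Φ′ (shrink p p≢X) (shrink q q≢X)
  inF-shrink {nothing}             _ _ = refl
  inF-shrink {just _}  {nothing}   _ _ = refl
  inF-shrink {just _}  {just _}    _ _ =
    sym (cong₂ (rel Φ) (FinP.punchIn-punchOut _) (FinP.punchIn-punchOut _))

  redirect : Maybe (Fin (suc k)) → Σ[ p ∈ Maybe (Fin (suc k)) ] p ≢ just X
  redirect nothing  = nothing , λ ()
  redirect (just Z) with X FinP.≟ Z
  ... | yes _   = t , t≢X
  ... | no  X≢Z = just Z , λ Z≡X → X≢Z (sym (just-injective Z≡X))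

  relabel : Maybe (Fin (suc k)) → Maybe (Fin k)
  relabel p = shrink (proj₁ (redirect p)) (proj₂ (redirect p))

  rowX≡inFt : ∀ q → inF Φ (just X) q ≡ inF Φ t q
  rowX≡inFt nothing  = sym (inF-sym Φ t nothing)
  rowX≡inFt (just Z) = rowX≡rowt Z

  inF-redirect : ∀ p q → inF Φ p q ≡ inF Φ (proj₁ (redirect p)) q
  inF-redirect nothing  q = refl
  inF-redirect (just Z) q with X FinP.≟ Z
  ... | yes refl = rowX≡inFt q
  ... | no  _    = refl

  inF-relabel : ∀ p q → inF Φ p q ≡ inF Φ′ (relabel p) (relabel q)
  inF-relabel p q = begin
    inF Φ p q   ≡⟨ inF-redirect p q ⟩
    inF Φ p′ q  ≡⟨ inF-sym Φ p′ q ⟩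
    inF Φ q p′  ≡⟨ inF-redirect q p′ ⟩
    inF Φ q′ p′ ≡⟨ inF-sym Φ q′ p′ ⟩
    inF Φ p′ q′ ≡⟨ inF-shrink (proj₂ (redirect p)) (proj₂ (redirect q)) ⟩
    inF Φ′ (relabel p) (relabel q) ∎
    where
    p′ q′ : Maybe (Fin (suc k))
    p′ = proj₁ (redirect p)
    q′ = proj₁ (redirect q)

  relabel-punchIn : ∀ a → relabel (just (punchIn X a)) ≡ just a
  relabel-punchIn a with X FinP.≟ punchIn X a
  ... | yes X≡ = ⊥-elim (FinP.punchInᵢ≢i X a (sym X≡))
  ... | no  _  = cong just (trans (FinP.punchOut-cong X refl) (FinP.punchOut-punchIn X))

  nonempty′ : ∀ a → Σ[ j ∈ Fin n ] relabel (assign P j) ≡ just a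
  nonempty′ a with nonempty P (punchIn X a)
  ... | j , j∈ = j , trans (cong relabel j∈) (relabel-punchIn a)

module SparePaths (m n k : ℕ) (P : Coarsening n (suc k)) (F : SymRel (suc k)) where

  M : ℕ
  M = m + 4

  path : Fin (M * n) → Fin M
  path = pathIdx M n

  column : Fin (M * n) → Fin n
  column = col M n

  part : Fin (M * n) → Maybe (Fin (suc k))
  part x = assign P (column x)

  ⟨_,_⟩ : Fin M → Fin n → Fin (M * n)
  ⟨ i , j ⟩ = combine i j

  path-⟨⟩ : ∀ i j → path ⟨ i , j ⟩ ≡ i
  path-⟨⟩ i j = cong proj₁ (FinP.remQuot-combine i j)

  column-⟨⟩ : ∀ i j → column ⟨ i , j ⟩ ≡ j
  column-⟨⟩ i j = cong proj₂ (FinP.remQuot-combine i j)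

  part-⟨⟩ : ∀ i j → part ⟨ i , j ⟩ ≡ assign P j
  part-⟨⟩ i j = cong (assign P) (column-⟨⟩ i j)

  apart : ∀ {x y} → path x ≢ path y → x ≢ y
  apart px≢py x≡y = px≢py (cong path x≡y)

  ⟨⟩-apart : ∀ {i i′ j j′} → i ≢ i′ → path ⟨ i , j ⟩ ≢ path ⟨ i′ , j′ ⟩
  ⟨⟩-apart {i} {i′} {j} {j′} i≢i′ eq =
    i≢i′ (trans (sym (path-⟨⟩ i j)) (trans eq (path-⟨⟩ i′ j′)))

  rep : Fin (suc k) → Fin n
  rep X = proj₁ (nonempty P X)

  rep-part : ∀ X → assign P (rep X) ≡ just X
  rep-part X = proj₂ (nonempty P X)

  OnFirstPaths : Fin (M * n) → Set
  OnFirstPaths x = toℕ (path x) < m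

  open FlipRepresentation (mPn M n) part OnFirstPaths

  G₀ : Graph (M * n)
  G₀ = flipPaths M n P F

  -- Only three of the four spare paths are needed.
  spare : Fin 4 → Fin M
  spare e = m ↑ʳ e

  E₀ E₁ E₂ : Fin M
  E₀ = spare Fin.zero
  E₁ = spare (Fin.suc Fin.zero)
  E₂ = spare (Fin.suc (Fin.suc Fin.zero))

  spare-≢ : ∀ {e e′} → e ≢ e′ → spare e ≢ spare e′
  spare-≢ e≢e′ eq = e≢e′ (FinP.↑ʳ-injective m _ _ eq)

  first≢spare : ∀ {y} e → OnFirstPaths y → path y ≢ spare e
  first≢spare e y-first py≡ = ℕP.<⇒≱ y-first
    (subst (m ≤_) (trans (sym (FinP.toℕ-↑ʳ m e)) (cong toℕ (sym py≡))) (ℕP.m≤m+n m (toℕ e)))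

  spare-off : ∀ {e j} → ¬ OnFirstPaths ⟨ spare e , j ⟩
  spare-off {e} {j} first = first≢spare e first (path-⟨⟩ (spare e) j)

  off≢first : ∀ {x y} → ¬ OnFirstPaths x → OnFirstPaths y → path x ≢ path y
  off≢first x-off y-first px≡py = x-off (subst (λ i → toℕ i < m) (sym px≡py) y-first)

  adj-mPn-apart : ∀ {x y} → path x ≢ path y → adj (mPn M n) x y ≡ false
  adj-mPn-apart px≢py rewrite eqF-≢ px≢py = refl

  adj-G₀ : ∀ {x y} → x ≢ y → adj G₀ x y ≡ adj (mPn M n) x y xor inF F (part x) (part y)
  adj-G₀ x≢y rewrite eqF-≢ x≢y = refl

  adj-G₀-apart : ∀ {x y} → path x ≢ path y → adj G₀ x y ≡ inF F (part x) (part y)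
  adj-G₀-apart px≢py rewrite adj-G₀ (apart px≢py) | adj-mPn-apart px≢py = refl

  profile-G₀ : ∀ {x X} → ¬ OnFirstPaths x → part x ≡ just X → HasProfile G₀ x (rel F X)
  profile-G₀ {X = X} x-off x∈X = hasProfile λ {y} y-first →
    trans (adj-G₀-apart (off≢first x-off y-first))
          (trans (cong (λ p → inF F p (part y)) x∈X) (inF-just F X (part y)))

  Beyond : Fin n → Fin (M * n) → Set
  Beyond c y = path y ≡ E₀ → toℕ c < toℕ (column y)

  beyond-first : ∀ {c y} → OnFirstPaths y → Beyond c y
  beyond-first y-first py≡E₀ = ⊥-elim (first≢spare _ y-first py≡E₀)

  beyond-spare : ∀ {c i j} → i ≢ E₀ → Beyond c ⟨ i , j ⟩
  beyond-spare {i = i} {j} i≢E₀ py≡E₀ = ⊥-elim (i≢E₀ (trans (sym (path-⟨⟩ i j)) py≡E₀))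

  beyond-E₀ : ∀ {c c′} → toℕ c < toℕ c′ → Beyond c ⟨ E₀ , c′ ⟩
  beyond-E₀ {c} {c′} c<c′ _ = subst (λ j → toℕ c < toℕ j) (sym (column-⟨⟩ E₀ c′)) c<c′

  not-beyond : ∀ {c c′} → toℕ c′ ≤ toℕ c → ¬ Beyond c ⟨ E₀ , c′ ⟩
  not-beyond {c} {c′} c′≤c beyond =
    ℕP.<⇒≱ (subst (λ j → toℕ c < toℕ j) (column-⟨⟩ E₀ c′) (beyond (path-⟨⟩ E₀ c′))) c′≤c

  beyond-≢ : ∀ {c c′ y} → toℕ c′ ≤ toℕ c → Beyond c y → ⟨ E₀ , c′ ⟩ ≢ y
  beyond-≢ {c} c′≤c = outside-≢ {A = Beyond c} (not-beyond c′≤c)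

  beyond-mono : ∀ {c c′ y} → toℕ c ≤ toℕ c′ → Beyond c′ y → Beyond c y
  beyond-mono c≤c′ beyond py≡E₀ = ℕP.≤-<-trans c≤c′ (beyond py≡E₀)

  adj-mPn-next : ∀ {c c′} → toℕ c′ ≡ suc (toℕ c) →
    adj (mPn M n) ⟨ E₀ , c ⟩ ⟨ E₀ , c′ ⟩ ≡ true
  adj-mPn-next {c} {c′} c′≡
    rewrite path-⟨⟩ E₀ c | path-⟨⟩ E₀ c′ | column-⟨⟩ E₀ c | column-⟨⟩ E₀ c′
          | eqF-refl E₀ | c′≡ | eqN-≡ {suc (toℕ c)} refl = refl

  adj-mPn-beyond : ∀ {c c′ y} → toℕ c′ ≡ suc (toℕ c) → Beyond c y → ⟨ E₀ , c′ ⟩ ≢ y →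
    adj (mPn M n) ⟨ E₀ , c ⟩ y ≡ false
  adj-mPn-beyond {c} {c′} {y} c′≡ beyond c′≢y
    rewrite path-⟨⟩ E₀ c | column-⟨⟩ E₀ c with E₀ FinP.≟ path y
  ... | no _ = refl
  ... | yes E₀≡py = consec-far (beyond (sym E₀≡py)) (λ eq → c′≢y (at-c′ (trans eq (sym c′≡))))
    where
    at-c′ : toℕ (column y) ≡ toℕ c′ → ⟨ E₀ , c′ ⟩ ≡ y
    at-c′ eq = trans (cong₂ ⟨_,_⟩ E₀≡py (sym (FinP.toℕ-injective eq))) (FinP.combine-remQuot {M} n y)

  record Walked (G : Graph (M * n)) (c : Fin n) (a : Fin (suc k) → Bool) : Set where
    field
      agrees : ∀ {x y} → Beyond c x → Beyond c y → adj G x y ≡ adj G₀ x y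
      leads  : ∀ {y} → Beyond c y → adj G ⟨ E₀ , c ⟩ y ≡ adj (mPn M n) ⟨ E₀ , c ⟩ y xor lift a (part y)

    isFlipOn : FlipOn G F
    isFlipOn = flipOn λ x-first y-first → agrees (beyond-first x-first) (beyond-first y-first)

    leader : HasProfile G ⟨ E₀ , c ⟩ a
    leader = hasProfile λ {y} y-first → trans (leads (beyond-first y-first))
      (cong (_xor lift a (part y)) (adj-mPn-apart (off≢first spare-off y-first)))

    profile : ∀ {x X} → Beyond c x → ¬ OnFirstPaths x → part x ≡ just X → HasProfile G x (rel F X)
    profile x-beyond x-off x∈X = hasProfile λ y-first →
      trans (agrees x-beyond (beyond-first y-first)) (adj-profile (profile-G₀ x-off x∈X) y-first)

    adj-apart : ∀ {x y} → Beyond c x → Beyond c y → path x ≢ path y → adj G x y ≡ inF F (part x) (part y)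
    adj-apart x-beyond y-beyond px≢py = trans (agrees x-beyond y-beyond) (adj-G₀-apart px≢py)

  leads-G₀ : ∀ {c y A} → assign P c ≡ just A → Beyond c y →
    adj G₀ ⟨ E₀ , c ⟩ y ≡ adj (mPn M n) ⟨ E₀ , c ⟩ y xor lift (rel F A) (part y)
  leads-G₀ {c} {y} {A} c∈A beyond
    = trans (adj-G₀ (beyond-≢ {c} ℕP.≤-refl beyond))
            (cong (adj (mPn M n) ⟨ E₀ , c ⟩ y xor_)
                  (trans (cong (λ p → inF F p (part y)) c-part) (inF-just F A (part y))))
    where
    c-part : part ⟨ E₀ , c ⟩ ≡ just A
    c-part = trans (part-⟨⟩ E₀ c) c∈A

  walked-start : ∀ {c A} → assign P c ≡ just A → Walked G₀ c (rel F A)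
  walked-start c∈A = record { agrees = λ _ _ → refl ; leads = leads-G₀ c∈A }

  restart : ∀ {G p c a A} → Walked G p a → toℕ p < toℕ c → assign P c ≡ just A → Walked G c (rel F A)
  restart {p = p} {c} walked p<c c∈A = record
    { agrees = λ x-beyond y-beyond → agrees (beyond-p x-beyond) (beyond-p y-beyond)
    ; leads  = λ y-beyond → trans (agrees (beyond-E₀ p<c) (beyond-p y-beyond)) (leads-G₀ c∈A y-beyond) }
    where
    open Walked walked
    beyond-p : ∀ {y} → Beyond c y → Beyond p y
    beyond-p = beyond-mono (ℕP.<⇒≤ p<c)

  walked-cong : ∀ {G c a b} → (∀ Z → a Z ≡ b Z) → Walked G c a → Walked G c b
  walked-cong {G} {c} {a} {b} a≗b walked = record { agrees = agrees ; leads = leads′ }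
    where
    open Walked walked
    leads′ : ∀ {y} → Beyond c y → adj G ⟨ E₀ , c ⟩ y ≡ adj (mPn M n) ⟨ E₀ , c ⟩ y xor lift b (part y)
    leads′ {y} beyond with part y | leads beyond
    ... | nothing | leads-y = leads-y
    ... | just Z  | leads-y = trans leads-y (cong (adj (mPn M n) ⟨ E₀ , c ⟩ y xor_) (a≗b Z))

  step : ∀ {G p z p′ a q} → Walked G p a → toℕ z ≡ suc (toℕ p) → toℕ p′ ≡ suc (toℕ z) →
    assign P z ≡ nothing → assign P p′ ≡ q →
    adj G ⟨ E₀ , p ⟩ ⟨ E₀ , z ⟩ ≡ true ×
    Walked (pivot G ⟨ E₀ , p ⟩ ⟨ E₀ , z ⟩) p′ (λ Z → a Z xor inF F q (just Z))
  step {G} {p} {z} {p′} {a} {q} walked z≡ p′≡ z∅ p′∈q = uv , record { agrees = agrees′ ; leads = leads′ }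
    where
    open Walked walked
    open ≡-Reasoning
    u v w : Fin (M * n)
    u = ⟨ E₀ , p ⟩
    v = ⟨ E₀ , z ⟩
    w = ⟨ E₀ , p′ ⟩
    p<z : toℕ p < toℕ z
    p<z = ℕP.≤-reflexive (sym z≡)
    z<p′ : toℕ z < toℕ p′
    z<p′ = ℕP.≤-reflexive (sym p′≡)
    p≤p′ : toℕ p ≤ toℕ p′
    p≤p′ = ℕP.<⇒≤ (ℕP.<-trans p<z z<p′)
    beyond-p : ∀ {y} → Beyond p′ y → Beyond p y
    beyond-p = beyond-mono p≤p′
    beyond-z : ∀ {y} → Beyond p′ y → Beyond z y
    beyond-z = beyond-mono (ℕP.<⇒≤ z<p′)
    w-off : ∀ {y} → Beyond p′ y → w ≢ y
    w-off = beyond-≢ {p′} ℕP.≤-refl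

    uv : adj G u v ≡ true
    uv rewrite leads (beyond-E₀ p<z) | adj-mPn-next {p} {z} z≡ | part-⟨⟩ E₀ z | z∅ = refl

    v-part : part v ≡ nothing
    v-part = trans (part-⟨⟩ E₀ z) z∅

    vw : adj G v w ≡ true
    vw = begin
      adj G v w
        ≡⟨ agrees (beyond-E₀ p<z) (beyond-E₀ (ℕP.<-trans p<z z<p′)) ⟩
      adj G₀ v w
        ≡⟨ adj-G₀ (beyond-≢ {z} ℕP.≤-refl (beyond-E₀ z<p′)) ⟩
      adj (mPn M n) v w xor inF F (part v) (part w)
        ≡⟨ cong₂ (λ e p → e xor inF F p (part w)) (adj-mPn-next p′≡) v-part ⟩
      true ∎

    v-pendant : ∀ {y} → Beyond z y → w ≢ y → adj G v y ≡ false
    v-pendant {y} beyond w≢y = begin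
      adj G v y
        ≡⟨ agrees (beyond-E₀ p<z) (beyond-mono (ℕP.<⇒≤ p<z) beyond) ⟩
      adj G₀ v y
        ≡⟨ adj-G₀ (beyond-≢ {z} ℕP.≤-refl beyond) ⟩
      adj (mPn M n) v y xor inF F (part v) (part y)
        ≡⟨ cong₂ (λ e p → e xor inF F p (part y)) (adj-mPn-beyond p′≡ beyond w≢y) v-part ⟩
      false ∎

    open PivotPendant G (Beyond z) uv (not-beyond (ℕP.<⇒≤ p<z)) (not-beyond ℕP.≤-refl)
                      (beyond-E₀ z<p′) vw v-pendant

    agrees′ : ∀ {x y} → Beyond p′ x → Beyond p′ y → adj (pivot G u v) x y ≡ adj G₀ x y
    agrees′ x-beyond y-beyond =
      trans (unchanged (beyond-z x-beyond) (beyond-z y-beyond) (w-off x-beyond) (w-off y-beyond))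
            (agrees (beyond-p x-beyond) (beyond-p y-beyond))

    row-shift : ∀ e r → (e xor inF F q r) xor (false xor lift a r) ≡ e xor lift (λ Z → a Z xor inF F q (just Z)) r
    row-shift e nothing rewrite inF-sym F q nothing = solve (e ∷ []) 𝔽₂
    row-shift e (just Z) with inF F q (just Z) | a Z
    ... | f | aZ = solve (e ∷ f ∷ aZ ∷ []) 𝔽₂

    leads′ : ∀ {y} → Beyond p′ y →
      adj (pivot G u v) w y ≡ adj (mPn M n) w y xor lift (λ Z → a Z xor inF F q (just Z)) (part y)
    leads′ {y} beyond = trans (added (beyond-z beyond) (w-off beyond)) added-profile
      where
      added-profile : adj G w y xor adj G u y ≡ adj (mPn M n) w y xor lift (λ Z → a Z xor inF F q (just Z)) (part y)
      added-profile = begin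
        adj G w y xor adj G u y
          ≡⟨ cong₂ _xor_ (trans (agrees (beyond-E₀ (ℕP.<-trans p<z z<p′)) (beyond-p beyond))
                                (adj-G₀ (w-off beyond)))
                         (leads (beyond-p beyond)) ⟩
        (adj (mPn M n) w y xor inF F (part w) (part y)) xor (adj (mPn M n) u y xor lift a (part y))
          ≡⟨ cong₂ (λ p e → (adj (mPn M n) w y xor inF F p (part y)) xor (e xor lift a (part y)))
                   (trans (part-⟨⟩ E₀ p′) p′∈q)
                   (adj-mPn-beyond z≡ (beyond-p beyond) (beyond-≢ {p′} (ℕP.<⇒≤ z<p′) beyond)) ⟩
        (adj (mPn M n) w y xor inF F q (part y)) xor (false xor lift a (part y))
          ≡⟨ row-shift (adj (mPn M n) w y) (part y) ⟩
        adj (mPn M n) w y xor lift (λ Z → a Z xor inF F q (just Z)) (part y) ∎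

  Reachable : Set
  Reachable = Σ[ G ∈ Graph (M * n) ] G₀ ≥ₚ G × Σ[ Φ ∈ SymRel (suc k) ] FlipOn G Φ × Mergeable Φ

  merge-into : ∀ {Φ : SymRel (suc k)} {X Y} → X ≢ Y → (∀ Z → rel Φ X Z ≡ rel Φ Y Z) → Mergeable Φ
  merge-into {X = X} {Y} X≢Y rows≡ = X , just Y , (λ Y≡X → X≢Y (sym (just-injective Y≡X))) , rows≡

  mergeOrSeparate : ∀ {G A Y} → G₀ ≥ₚ G → FlipOn G F → A ≢ Y →
    (∀ W → rel F A W ≡ not (rel F Y W) → Reachable) → Reachable
  mergeOrSeparate {G} {A} {Y} G₀≥G G↦F A≢Y continue with FinP.all? (λ W → rel F A W Bool.≟ rel F Y W)
  ... | yes rows≡ = G , G₀≥G , F , G↦F , merge-into A≢Y rows≡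
  ... | no  rows≢ with FinP.¬∀⟶∃¬ _ _ (λ W → rel F A W Bool.≟ rel F Y W) rows≢
  ...   | W , AW≢YW = continue W (Bool.¬-not AW≢YW)

  witness : Fin (suc k) → Fin (M * n)
  witness W = ⟨ E₂ , rep W ⟩

  witness-part : ∀ W → part (witness W) ≡ just W
  witness-part W = trans (part-⟨⟩ E₂ (rep W)) (rep-part W)

  E₀≢E₁ : E₀ ≢ E₁
  E₀≢E₁ = spare-≢ λ ()

  E₀≢E₂ : E₀ ≢ E₂
  E₀≢E₂ = spare-≢ λ ()

  E₁≢E₂ : E₁ ≢ E₂
  E₁≢E₂ = spare-≢ λ ()

  module AllLooped (loop : ∀ X → rel F X X ≡ true) where

    module FinishAdjacent {G p l A Y} (G₀≥G : G₀ ≥ₚ G) (walked : Walked G p (rel F A))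
                          (l≡ : toℕ l ≡ suc (toℕ p)) (l∈Y : assign P l ≡ just Y) (A≢Y : A ≢ Y) where
      open Walked walked

      u y v : Fin (M * n)
      u = ⟨ E₀ , p ⟩
      y = ⟨ E₀ , l ⟩
      v = ⟨ E₁ , l ⟩

      y-beyond : Beyond p y
      y-beyond = beyond-E₀ (ℕP.≤-reflexive (sym l≡))
      v-beyond : Beyond p v
      v-beyond = beyond-spare (E₀≢E₁ ∘ sym)
      y-part : part y ≡ just Y
      y-part = trans (part-⟨⟩ E₀ l) l∈Y
      v-part : part v ≡ just Y
      v-part = trans (part-⟨⟩ E₁ l) l∈Y

      uy : adj G u y ≡ not (rel F A Y)
      uy rewrite leads y-beyond | adj-mPn-next {p} {l} l≡ | y-part = refl

      pivotWithNext : rel F A Y ≡ false → Reachable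
      pivotWithNext AY = pivot G u y , ≥ₚ-trans G₀≥G (piv u y uy′ done) , F ⊕ rel F A ⊗ rel F Y ,
                         pivot-flipOn isFlipOn leader (profile y-beyond spare-off y-part) spare-off spare-off uy′ ,
                         merge-into A≢Y (⊕⊗-merge-rows F (loop A) (loop Y) AY)
        where
        uy′ : adj G u y ≡ true
        uy′ = trans uy (cong not AY)

      -- The copy v of column l on E₁ gives y the profile F(A,·) + F(Y,·).
      pivotViaCopy : rel F A Y ≡ true → ∀ W → rel F A W ≡ not (rel F Y W) → Reachable
      pivotViaCopy AY W AW≡ = pivot G₁ y w , ≥ₚ-trans G₀≥G (piv u v uv (piv y w yw done)) , Φ₁ ⊕ d ⊗ c ,
                              pivot-flipOn flipOn₁ y↦d w↦c spare-off spare-off yw ,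
                              merge-into A≢Y (⊕⊗-merge-via-copy F (loop A) (loop Y) AY AW≡)
        where
        w : Fin (M * n)
        w = witness W
        w-beyond : Beyond p w
        w-beyond = beyond-spare (E₀≢E₂ ∘ sym)
        uy′ : adj G u y ≡ false
        uy′ = trans uy (cong not AY)
        uv : adj G u v ≡ true
        uv rewrite leads v-beyond | adj-mPn-apart (⟨⟩-apart {j = p} {l} E₀≢E₁) | v-part | AY = refl
        vy : adj G v y ≡ true
        vy rewrite adj-apart v-beyond y-beyond (⟨⟩-apart (E₀≢E₁ ∘ sym)) | v-part | y-part = loop Y
        uw : adj G u w ≡ rel F A W
        uw rewrite leads w-beyond | adj-mPn-apart (⟨⟩-apart {j = p} {rep W} E₀≢E₂) | witness-part W = refl
        vw : adj G v w ≡ rel F Y W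
        vw rewrite adj-apart v-beyond w-beyond (⟨⟩-apart E₁≢E₂) | v-part | witness-part W = refl

        G₁ : Graph (M * n)
        G₁ = pivot G u v
        Φ₁ : SymRel (suc k)
        Φ₁ = F ⊕ rel F A ⊗ rel F Y
        d c : Fin (suc k) → Bool
        d Z = rel F Y Z xor rel F A Z
        c Z = rel F W Z xor ((rel F A W ∧ rel F Y Z) xor (rel F Y W ∧ rel F A Z))

        flipOn₁ : FlipOn G₁ Φ₁
        flipOn₁ = pivot-flipOn isFlipOn leader (profile v-beyond spare-off v-part) spare-off spare-off uv
        y↦d : HasProfile G₁ y d
        y↦d = pivot-profile leader (profile v-beyond spare-off v-part) (profile y-beyond spare-off y-part)
                spare-off spare-off spare-off uv
                (beyond-≢ {p} ℕP.≤-refl y-beyond) (apart (⟨⟩-apart (E₀≢E₁ ∘ sym))) uy′ vy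
        w↦c : HasProfile G₁ w c
        w↦c = pivot-profile leader (profile v-beyond spare-off v-part) (profile w-beyond spare-off (witness-part W))
                spare-off spare-off spare-off uv
                (beyond-≢ {p} ℕP.≤-refl w-beyond) (apart (⟨⟩-apart E₁≢E₂)) uw vw
        yw : adj G₁ y w ≡ true
        yw rewrite adj-pivot G uv (apart (⟨⟩-apart E₀≢E₂))
                     (beyond-≢ {p} ℕP.≤-refl y-beyond) (beyond-≢ {p} ℕP.≤-refl w-beyond)
                     (apart (⟨⟩-apart (E₀≢E₁ ∘ sym))) (apart (⟨⟩-apart E₁≢E₂))
                 | adj-apart y-beyond w-beyond (⟨⟩-apart E₀≢E₂) | y-part | witness-part W
                 | uy′ | vy | uw | AW≡ = Bool.xor-inverseʳ (rel F Y W)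

    finishAdjacent : ∀ {G p l A Y} → G₀ ≥ₚ G → Walked G p (rel F A) → toℕ l ≡ suc (toℕ p) →
      assign P l ≡ just Y → A ≢ Y → Reachable
    finishAdjacent {A = A} {Y} G₀≥G walked l≡ l∈Y A≢Y with rel F A Y in AY
    ... | false = pivotWithNext AY
      where open FinishAdjacent G₀≥G walked l≡ l∈Y A≢Y
    ... | true  = mergeOrSeparate G₀≥G (Walked.isFlipOn walked) A≢Y (pivotViaCopy AY)
      where open FinishAdjacent G₀≥G walked l≡ l∈Y A≢Y

    finishAcrossGap : ∀ {G p z l A Y} → G₀ ≥ₚ G → Walked G p (rel F A) →
      toℕ z ≡ suc (toℕ p) → toℕ l ≡ suc (toℕ z) → assign P z ≡ nothing → assign P l ≡ just Y → A ≢ Y →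
      Reachable
    finishAcrossGap {G} {p} {z} {l} {A} {Y} G₀≥G walked z≡ l≡ z∅ l∈Y A≢Y with step walked z≡ l≡ z∅ l∈Y
    ... | uz , walked′ = mergeOrSeparate G₀≥G₁ isFlipOn A≢Y onePivot
      where
      open Walked walked′
      G₀≥G₁ : G₀ ≥ₚ pivot G ⟨ E₀ , p ⟩ ⟨ E₀ , z ⟩
      G₀≥G₁ = ≥ₚ-trans G₀≥G (piv _ _ uz done)
      y : Fin (M * n)
      y = ⟨ E₀ , l ⟩
      onePivot : ∀ W → rel F A W ≡ not (rel F Y W) → Reachable
      onePivot W AW≡ = pivot (pivot G ⟨ E₀ , p ⟩ ⟨ E₀ , z ⟩) y w , ≥ₚ-trans G₀≥G₁ (piv y w yw done) ,
                       F ⊕ (λ Z → rel F A Z xor rel F Y Z) ⊗ rel F W ,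
                       pivot-flipOn isFlipOn leader (profile w-beyond spare-off (witness-part W)) spare-off spare-off yw ,
                       merge-into A≢Y
                         (⊕⊗-merge-difference F (trans (loop A) (sym (loop Y))) (λ _ → refl) separates)
        where
        w : Fin (M * n)
        w = witness W
        w-beyond : Beyond l w
        w-beyond = beyond-spare (E₀≢E₂ ∘ sym)
        yw : adj (pivot G ⟨ E₀ , p ⟩ ⟨ E₀ , z ⟩) y w ≡ true
        yw rewrite leads w-beyond | adj-mPn-apart (⟨⟩-apart {j = l} {rep W} E₀≢E₂) | witness-part W | AW≡ =
          Bool.xor-inverseˡ (rel F Y W)
        separates : rel F W A ≡ not (rel F W Y)
        separates = trans (relSym F W A) (trans AW≡ (cong not (relSym F Y W)))

    -- Walk along E₀ from a column of part A towards b; columns of part A met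
    -- on the way restart the walk, the first column of another part ends it.
    module Towards {b : Fin n} {B : Fin (suc k)} (b∈B : assign P b ≡ just B) where

      nextColumn : ∀ {p : Fin n} {d} → suc (toℕ p) + suc d ≡ toℕ b → Σ[ c ∈ Fin n ] toℕ c ≡ suc (toℕ p)
      nextColumn {p} {d} reach = fromℕ< c<n , FinP.toℕ-fromℕ< c<n
        where
        c<n : suc (toℕ p) < n
        c<n = ℕP.<-trans (subst (suc (toℕ p) <_) reach (ℕP.m<m+n _ (s≤s z≤n))) (FinP.toℕ<n b)

      reach-next : ∀ {p c : Fin n} {d} → toℕ c ≡ suc (toℕ p) →
        suc (toℕ p) + suc d ≡ toℕ b → suc (toℕ c) + d ≡ toℕ b
      reach-next {p} {c} {d} c≡ reach =
        trans (cong (λ i → suc i + d) c≡) (trans (sym (ℕP.+-suc (suc (toℕ p)) d)) reach)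

      walk : ∀ d {G p A} → G₀ ≥ₚ G → Walked G p (rel F A) → A ≢ B → suc (toℕ p) + d ≡ toℕ b → Reachable
      acrossGap : ∀ d {G p c A} → G₀ ≥ₚ G → Walked G p (rel F A) → A ≢ B → toℕ c ≡ suc (toℕ p) →
        assign P c ≡ nothing → suc (toℕ c) + d ≡ toℕ b → Reachable

      walk zero G₀≥G walked A≢B reach =
        finishAdjacent G₀≥G walked (trans (sym reach) (ℕP.+-identityʳ _)) b∈B A≢B
      walk (suc d) {p = p} {A} G₀≥G walked A≢B reach = visit (nextColumn reach)
        where
        visit : Σ[ c ∈ Fin n ] toℕ c ≡ suc (toℕ p) → Reachable
        visit (c , c≡) with assign P c in c∈
        ... | nothing = acrossGap d G₀≥G walked A≢B c≡ c∈ (reach-next c≡ reach)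
        ... | just Y with Y FinP.≟ A
        ...   | yes refl =
          walk d G₀≥G (restart walked (ℕP.≤-reflexive (sym c≡)) c∈) A≢B (reach-next c≡ reach)
        ...   | no  Y≢A  = finishAdjacent G₀≥G walked c≡ c∈ (Y≢A ∘ sym)

      acrossGap zero G₀≥G walked A≢B c≡ c∅ reach =
        finishAcrossGap G₀≥G walked c≡ (trans (sym reach) (ℕP.+-identityʳ _)) c∅ b∈B A≢B
      acrossGap (suc d) {G} {p} {c} {A} G₀≥G walked A≢B c≡ c∅ reach = visit (nextColumn reach)
        where
        visit : Σ[ c′ ∈ Fin n ] toℕ c′ ≡ suc (toℕ c) → Reachable
        visit (c′ , c′≡) with assign P c′ in c′∈
        ... | nothing with step walked c≡ c′≡ c∅ c′∈
        ...   | uc , walked′ =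
          walk d (≥ₚ-trans G₀≥G (piv _ _ uc done)) (walked-cong (λ Z → Bool.xor-identityʳ (rel F A Z)) walked′)
               A≢B (reach-next c′≡ reach)
        visit (c′ , c′≡) | just Y with Y FinP.≟ A
        ...   | yes refl = walk d G₀≥G (restart walked p<c′ c′∈) A≢B (reach-next c′≡ reach)
          where
          p<c′ : toℕ p < toℕ c′
          p<c′ = ℕP.<-trans (ℕP.≤-reflexive (sym c≡)) (ℕP.≤-reflexive (sym c′≡))
        ...   | no  Y≢A  = finishAcrossGap G₀≥G walked c≡ c′≡ c∅ c′∈ (Y≢A ∘ sym)

    startWalk : ∀ {a b A B} → toℕ a < toℕ b →
      assign P a ≡ just A → assign P b ≡ just B → A ≢ B → Reachable
    startWalk {a} {b} a<b a∈A b∈B A≢B =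
      Towards.walk b∈B (toℕ b ∸ suc (toℕ a)) done (walked-start a∈A) A≢B (ℕP.m+[n∸m]≡n a<b)

    fromTwoParts : (X Y : Fin (suc k)) → X ≢ Y → Reachable
    fromTwoParts X Y X≢Y with ℕP.<-cmp (toℕ (rep X)) (toℕ (rep Y))
    ... | tri< lt _ _ = startWalk lt (rep-part X) (rep-part Y) X≢Y
    ... | tri≈ _ eq _ = ⊥-elim (X≢Y (just-injective
            (trans (sym (rep-part X)) (trans (cong (assign P) (FinP.toℕ-injective eq)) (rep-part Y)))))
    ... | tri> _ _ gt = startWalk gt (rep-part Y) (rep-part X) (X≢Y ∘ sym)

  loopless : ∀ X → rel F X X ≡ false → Reachable
  loopless X XX with FinP.any? (λ Z → rel F X Z Bool.≟ true)
  ... | no isolated = G₀ , done , F , flipOn (λ _ _ → refl) , X , nothing , (λ ()) ,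
                      λ Z → Bool.¬-not λ XZ → isolated (Z , XZ)
  ... | yes (Z , XZ) = pivot G₀ u v , piv u v uv done , F ⊕ rel F X ⊗ rel F Z ,
                       pivot-flipOn (flipOn (λ _ _ → refl)) (profile-G₀ spare-off u-part)
                                    (profile-G₀ spare-off v-part) spare-off spare-off uv ,
                       X , nothing , (λ ()) , ⊕⊗-zero-row F XX XZ
    where
    u v : Fin (M * n)
    u = ⟨ E₀ , rep X ⟩
    v = ⟨ E₁ , rep Z ⟩
    u-part : part u ≡ just X
    u-part = trans (part-⟨⟩ E₀ (rep X)) (rep-part X)
    v-part : part v ≡ just Z
    v-part = trans (part-⟨⟩ E₁ (rep Z)) (rep-part Z)
    uv : adj G₀ u v ≡ true
    uv rewrite adj-G₀-apart (⟨⟩-apart {j = rep X} {rep Z} E₀≢E₁) | u-part | v-part = XZ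

  reachable : (X Y : Fin (suc k)) → X ≢ Y → Reachable
  reachable X Y X≢Y with FinP.any? (λ Z → rel F Z Z Bool.≟ false)
  ... | yes (Z , ZZ) = loopless Z ZZ
  ... | no  looped   = AllLooped.fromTwoParts (λ Z → Bool.¬-not λ ZZ → looped (Z , ZZ)) X Y X≢Y

  ι : Fin (m * n) → Fin (M * n)
  ι x = ⟨ pathIdx m n x ↑ˡ 4 , col m n x ⟩

  toℕ-ι : ∀ x → toℕ (ι x) ≡ toℕ x
  toℕ-ι x = begin
    toℕ (combine (i ↑ˡ 4) j)      ≡⟨ FinP.toℕ-combine (i ↑ˡ 4) j ⟩
    n * toℕ (i ↑ˡ 4) + toℕ j      ≡⟨ cong (λ t → n * t + toℕ j) (FinP.toℕ-↑ˡ i 4) ⟩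
    n * toℕ i + toℕ j             ≡⟨ FinP.toℕ-combine i j ⟨
    toℕ (combine i j)             ≡⟨ cong toℕ (FinP.combine-remQuot {m} n x) ⟩
    toℕ x                         ∎
    where
    open ≡-Reasoning
    i = pathIdx m n x
    j = col m n x

  ι-first : ∀ x → OnFirstPaths (ι x)
  ι-first x = subst (λ i → toℕ i < m) (sym (path-⟨⟩ (pathIdx m n x ↑ˡ 4) (col m n x)))
                    (subst (_< m) (sym (FinP.toℕ-↑ˡ (pathIdx m n x) 4)) (FinP.toℕ<n (pathIdx m n x)))

  adj-ι : ∀ {Φ} (merged : Merged P Φ) x y →
    adj (flipBy Φ) (ι x) (ι y) ≡ adj (flipPaths m n (Merged.coarsening merged) (Merged.relation merged)) x y
  adj-ι merged x y
    rewrite path-⟨⟩ (pathIdx m n x ↑ˡ 4) (col m n x) | path-⟨⟩ (pathIdx m n y ↑ˡ 4) (col m n y)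
          | column-⟨⟩ (pathIdx m n x ↑ˡ 4) (col m n x) | column-⟨⟩ (pathIdx m n y ↑ˡ 4) (col m n y)
          | eqF-cong-toℕ (FinP.toℕ-↑ˡ (pathIdx m n x) 4) (FinP.toℕ-↑ˡ (pathIdx m n y) 4)
          | eqF-cong-toℕ (toℕ-ι x) (toℕ-ι y)
          | Merged.inF-merged merged (col m n x) (col m n y)
    = refl

  conclude : Reachable → Σ[ N ∈ ℕ ] Σ[ H ∈ Graph N ] (G₀ ≥ₚ H) × IsoKFlipped k m n H
  conclude (G , G₀≥G , Φ , G↦Φ , mergeable) =
    m * n , graph , ≥ₚ-trans G₀≥G isMinor , k , ℕP.≤-refl , coarsening , relation , ↔-id _ , adj-graph
    where
    merged : Merged P Φ
    merged = merge P Φ mergeable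
    open Merged merged
    open InitialSegment (initialSegment (ℕP.≤⇒≤′ (ℕP.*-monoˡ-≤ n (ℕP.m≤m+n m 4))) G)
    adj-graph : ∀ x y → adj (flipPaths m n coarsening relation) x y ≡ adj graph x y
    adj-graph x y = begin
      adj (flipPaths m n coarsening relation) x y   ≡⟨ sym (adj-ι merged x y) ⟩
      adj (flipBy Φ) (ι x) (ι y)                    ≡⟨ sym (adj-flip G↦Φ (ι-first x) (ι-first y)) ⟩
      adj G (ι x) (ι y)                             ≡⟨ cong₂ (adj G) (embed≡ι x) (embed≡ι y) ⟨
      adj G (embed x) (embed y)                     ≡⟨ adj-embed x y ⟨
      adj graph x y                                 ∎
      where
      open ≡-Reasoning
      embed≡ι : ∀ x → embed x ≡ ι x
      embed≡ι x = FinP.toℕ-injective (trans (toℕ-embed x) (sym (toℕ-ι x)))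

corollary3p9 : (m n k : ℕ) → 1 ≤ m → 1 ≤ n → 2 ≤ k →
    (P : Coarsening n k) (F : SymRel k) →
    Σ[ N ∈ ℕ ] Σ[ H ∈ Graph N ]
      (flipPaths (m + 4) n P F ≥ₚ H) × IsoKFlipped (k ∸ 1) m n H
corollary3p9 m n (suc (suc k)) _ _ (s≤s (s≤s _)) P F =
  conclude (reachable Fin.zero (Fin.suc Fin.zero) λ ())
  where open SparePaths m n (suc k) P F
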